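{- Let $n\ge 2$. If $\Gamma(\mathbb{Z}_n)$ has at least one vertex and is regular, then $\Gamma(\mathbb{Z}_n)$ is complete. (Equivalently, there is no $\Gamma(\mathbb{Z}_n)$ that is non-empty, non-complete and regular.)
   Context: For a commutative ring $R$ with identity, the zero-divisor graph $\Gamma(R)$ is the simple undirected graph whose vertices are the nonzero zero-divisors of $R$, two distinct vertices $u,v$ being adjacent iff $uv=0$. A graph is regular if all vertices have the same degree. -}

module Defs where

open import Data.Nat using (ℕ; zero; suc; _*_; _%_; _≟_; NonZero)
open import Data.Fin using (Fin; toℕ)
open import Data.Fin.Properties using (any?)
open import Data.List using (List; length; filter)
open import Data.List using () renaming (allFin to allFinL)
open import Data.Product using (Σ; _×_; _,_)
open import Relation.Nullary using (¬_; Dec)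
open import Relation.Nullary.Decidable using (_×-dec_; ¬?)
open import Relation.Binary.PropositionalEquality using (_≡_; _≢_)

-- The ring ℤ_n, modelled as residues Fin n with multiplication (a*b) mod n.
-- zero-product in ℤ_n: a·b = 0 in ℤ_n
ZeroProd : (n : ℕ) → .{{NonZero n}} → Fin n → Fin n → Set
ZeroProd n a b = (toℕ a * toℕ b) % n ≡ 0

zeroProd? : (n : ℕ) → .{{_ : NonZero n}} → (a b : Fin n) → Dec (ZeroProd n a b)
zeroProd? n a b = ((toℕ a * toℕ b) % n) ≟ 0

NonZeroElt : {n : ℕ} → Fin n → Set
NonZeroElt a = toℕ a ≢ 0

nonZeroElt? : {n : ℕ} → (a : Fin n) → Dec (NonZeroElt a)
nonZeroElt? a = ¬? (toℕ a ≟ 0)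

IsVertex : (n : ℕ) → .{{NonZero n}} → Fin n → Set
IsVertex n a = NonZeroElt a × Σ (Fin n) (λ b → NonZeroElt b × ZeroProd n a b)

isVertex? : (n : ℕ) → .{{_ : NonZero n}} → (a : Fin n) → Dec (IsVertex n a)
isVertex? n a = nonZeroElt? a ×-dec any? (λ b → nonZeroElt? b ×-dec zeroProd? n a b)

Adj : (n : ℕ) → .{{NonZero n}} → Fin n → Fin n → Set
Adj n u v = IsVertex n u × IsVertex n v × (u ≢ v) × ZeroProd n u v

adj? : (n : ℕ) → .{{_ : NonZero n}} → (u v : Fin n) → Dec (Adj n u v)
adj? n u v = isVertex? n u ×-dec (isVertex? n v ×-dec (¬? (u Data.Fin.≟ v) ×-dec zeroProd? n u v))

degree : (n : ℕ) → .{{_ : NonZero n}} → Fin n → ℕ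
degree n u = length (filter (adj? n u) (allFinL n))

NonEmptyΓ : (n : ℕ) → .{{NonZero n}} → Set
NonEmptyΓ n = Σ (Fin n) (IsVertex n)

RegularΓ : (n : ℕ) → .{{NonZero n}} → Set
RegularΓ n = (u v : Fin n) → IsVertex n u → IsVertex n v → degree n u ≡ degree n v

CompleteΓ : (n : ℕ) → .{{NonZero n}} → Set
CompleteΓ n = (u v : Fin n) → IsVertex n u → IsVertex n v → u ≢ v → ZeroProd n u v

-- Write n = m p with p the least divisor ≥ 2 of n; then p is prime and p ≤ m unless m = 1.
-- If m = 1, n is prime and Γ(ℤ_n) has no vertex. If m = p, every vertex is a multiple of p,
-- so any two vertices multiply to 0. If p < m, the vertex p is adjacent only to nonzero
-- multiples of m, of which there are p − 1, while m is adjacent to every nonzero multiple of p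
-- other than m itself, of which there are at least p (m − 2 ≥ p unless m = p + 1, which is not
-- a multiple of p); so Γ(ℤ_n) is not regular.

module Submission where

open import Defs
open import Data.Nat
open import Data.Nat.Properties
open import Data.Nat.Divisibility
open import Data.Nat.Primality
open import Data.Fin using (Fin; toℕ; fromℕ<)
open import Data.Fin.Properties using (toℕ<n; toℕ-fromℕ<; toℕ-injective)
open import Data.List using (List; []; _∷_; length; filter; map; applyUpTo)
open import Data.List using () renaming (allFin to allFinL)
open import Data.List.Properties using (length-map; length-applyUpTo; length-removeAt′; filter-all)
open import Data.List.Relation.Unary.All as All using (All; []; _∷_)
import Data.List.Relation.Unary.All.Properties as AllP
open import Data.List.Relation.Unary.Any using (here; there; index)
open import Data.List.Membership.Propositional using (_∈_; _─_)
open import Data.List.Membership.Propositional.Properties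
  using (∈-map⁺; ∈-map⁻; ∈-filter⁺; ∈-filter⁻; ∈-allFin; ∈-applyUpTo⁺; ∈-applyUpTo⁻)
open import Data.List.Relation.Unary.Unique.Propositional using (Unique)
import Data.List.Relation.Unary.Unique.Propositional.Properties as Unique
open import Data.List.Relation.Unary.AllPairs using ([]; _∷_)
open import Data.Product using (∃-syntax; _×_; _,_; proj₁; proj₂)
open import Data.Sum using (_⊎_; inj₁; inj₂)
open import Relation.Nullary using (¬_; Dec; yes; no; contradiction)
open import Relation.Nullary.Decidable using (¬?)
open import Relation.Binary.PropositionalEquality

∈-─⁺ : {A : Set} {x y : A} {ys : List A} (x∈ys : x ∈ ys) → y ∈ ys → x ≢ y → y ∈ ys ─ x∈ys
∈-─⁺ (here refl) (here refl) x≢y = contradiction refl x≢y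
∈-─⁺ (here _)    (there y∈ys) _  = y∈ys
∈-─⁺ (there _)   (here y≡z)   _  = here y≡z
∈-─⁺ (there x∈ys) (there y∈ys) x≢y = there (∈-─⁺ x∈ys y∈ys x≢y)

unique⊆⇒length≤ : {A : Set} {xs ys : List A} → Unique xs → All (_∈ ys) xs → length xs ≤ length ys
unique⊆⇒length≤ [] [] = z≤n
unique⊆⇒length≤ {ys = ys} (x∉xs ∷ xs-unique) (x∈ys ∷ xs⊆ys) =
  subst (_ ≤_) (sym (length-removeAt′ ys (index x∈ys)))
    (s≤s (unique⊆⇒length≤ xs-unique
      (All.zipWith (λ (x≢y , y∈ys) → ∈-─⁺ x∈ys y∈ys x≢y) (x∉xs , xs⊆ys))))

_≢?_ : (x c : ℕ) → Dec (x ≢ c)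
x ≢? c = ¬? (x ≟ c)

without : ℕ → List ℕ → List ℕ
without c = filter (_≢? c)

length≤suc-length-without : ∀ c {xs} → Unique xs → length xs ≤ suc (length (without c xs))
length≤suc-length-without c {xs} xs-unique = unique⊆⇒length≤ xs-unique (All.tabulate xs⊆c∷without)
  where
  xs⊆c∷without : ∀ {x} → x ∈ xs → x ∈ c ∷ without c xs
  xs⊆c∷without {x} x∈xs with x ≟ c
  ... | yes x≡c = here x≡c
  ... | no  x≢c = there (∈-filter⁺ (_≢? c) x∈xs x≢c)

multiples : ℕ → ℕ → List ℕ
multiples d k = applyUpTo (λ i → suc i * d) k

multiples-unique : ∀ d k .{{_ : NonZero d}} → Unique (multiples d k)
multiples-unique d k = Unique.applyUpTo⁺₁ _ k
  (λ {i} {j} i<j _ eq → <⇒≢ i<j (suc-injective (*-cancelʳ-≡ (suc i) (suc j) d eq)))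

∈-multiples⁺ : ∀ {d k v} → v ≢ 0 → v < k * d → d ∣ v → v ∈ multiples d (pred k)
∈-multiples⁺ v≢0 v<kd (divides zero refl) = contradiction refl v≢0
∈-multiples⁺ {d} {k} v≢0 v<kd (divides (suc i) refl) =
  ∈-applyUpTo⁺ (λ i → suc i * d) (<⇒≤pred (*-cancelʳ-< d (suc i) k v<kd))

m∣n∧n<m⇒n≡0 : ∀ {m n} → m ∣ n → n < m → n ≡ 0
m∣n∧n<m⇒n≡0 {n = zero}  _   _   = refl
m∣n∧n<m⇒n≡0 {n = suc _} m∣n n<m = contradiction (∣⇒≤ m∣n) (<⇒≱ n<m)

fromℕ<-nonZeroElt : ∀ {k n} .{{_ : NonZero k}} (k<n : k < n) → NonZeroElt (fromℕ< k<n)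
fromℕ<-nonZeroElt {k} k<n eq = ≢-nonZero⁻¹ k (trans (sym (toℕ-fromℕ< k<n)) eq)

∣-fromℕ< : ∀ {a b n} (a<n : a < n) (b<n : b < n) → n ∣ a * b → n ∣ toℕ (fromℕ< a<n) * toℕ (fromℕ< b<n)
∣-fromℕ< a<n b<n rewrite toℕ-fromℕ< a<n | toℕ-fromℕ< b<n = λ n∣ab → n∣ab

module _ {n : ℕ} .{{_ : NonZero n}} where

  zeroProd⇒∣ : {a b : Fin n} → ZeroProd n a b → n ∣ toℕ a * toℕ b
  zeroProd⇒∣ = m%n≡0⇒n∣m _ n

  ∣⇒zeroProd : {a b : Fin n} → n ∣ toℕ a * toℕ b → ZeroProd n a b
  ∣⇒zeroProd = n∣m⇒m%n≡0 _ n

  ∤-nonZeroElt : {a : Fin n} → NonZeroElt a → ¬ n ∣ toℕ a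
  ∤-nonZeroElt {a} a≢0 n∣a = a≢0 (m∣n∧n<m⇒n≡0 n∣a (toℕ<n a))

  isVertex : {a b : Fin n} → NonZeroElt a → NonZeroElt b → n ∣ toℕ a * toℕ b → IsVertex n a
  isVertex {a} {b} a≢0 b≢0 n∣ab = a≢0 , b , b≢0 , ∣⇒zeroProd {a} {b} n∣ab

  adjacent : {u v : Fin n} → IsVertex n u → NonZeroElt v → u ≢ v → n ∣ toℕ u * toℕ v → Adj n u v
  adjacent {u} {v} u-vertex v≢0 u≢v n∣uv =
    u-vertex , isVertex {v} {u} v≢0 (proj₁ u-vertex) (subst (n ∣_) (*-comm (toℕ u) (toℕ v)) n∣uv) ,
    u≢v , ∣⇒zeroProd {u} {v} n∣uv

  module _ (u : Fin n) where

    neighbours : List ℕ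
    neighbours = map toℕ (filter (adj? n u) (allFinL n))

    ∈-neighbours : ∀ {v} → Adj n u v → toℕ v ∈ neighbours
    ∈-neighbours {v} u~v = ∈-map⁺ toℕ (∈-filter⁺ (adj? n u) (∈-allFin v) u~v)

    degree≤ : {ys : List ℕ} → (∀ {v} → Adj n u v → toℕ v ∈ ys) → degree n u ≤ length ys
    degree≤ bound = subst (_≤ _) (length-map toℕ (filter (adj? n u) (allFinL n)))
      (unique⊆⇒length≤ neighbours-unique (All.tabulate neighbours⊆))
      where
      neighbours-unique : Unique neighbours
      neighbours-unique = Unique.map⁺ toℕ-injective (Unique.filter⁺ (adj? n u) (Unique.allFin⁺ n))
      neighbours⊆ : ∀ {y} → y ∈ neighbours → y ∈ _
      neighbours⊆ y∈ with v , v∈ , refl ← ∈-map⁻ toℕ y∈ =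
        bound (proj₂ (∈-filter⁻ (adj? n u) {xs = allFinL n} v∈))

    ≤degree : {ys : List ℕ} → Unique ys → (∀ {y} → y ∈ ys → ∃[ v ] toℕ v ≡ y × Adj n u v) →
              length ys ≤ degree n u
    ≤degree ys-unique realise = subst (_ ≤_) (length-map toℕ (filter (adj? n u) (allFinL n)))
      (unique⊆⇒length≤ ys-unique (All.tabulate λ y∈ys → witness (realise y∈ys)))
      where
      witness : ∀ {y} → ∃[ v ] toℕ v ≡ y × Adj n u v → y ∈ neighbours
      witness (v , refl , u~v) = ∈-neighbours u~v

module _ {p : ℕ} (p-prime : Prime p) where

  private instance
    p≢0 : NonZero p
    p≢0 = prime⇒nonZero p-prime

  prime-¬IsVertex : ∀ {a} → ¬ IsVertex p a
  prime-¬IsVertex {a} (a≢0 , b , b≢0 , ab≡0)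
    with euclidsLemma (toℕ a) (toℕ b) p-prime (zeroProd⇒∣ {a = a} {b} ab≡0)
  ... | inj₁ p∣a = ∤-nonZeroElt a≢0 p∣a
  ... | inj₂ p∣b = ∤-nonZeroElt b≢0 p∣b

  prime²∣m*n⇒∣ : ∀ m n → n ≢ 0 → n < p * p → p * p ∣ m * n → p ∣ m
  prime²∣m*n⇒∣ m n n≢0 n<p² p²∣mn with euclidsLemma m n p-prime (∣-trans (m∣m*n p) p²∣mn)
  ... | inj₁ p∣m = p∣m
  ... | inj₂ (divides c refl)
    with euclidsLemma m c p-prime (*-cancelʳ-∣ p (subst (p * p ∣_) (sym (*-assoc m c p)) p²∣mn))
  ...   | inj₁ p∣m = p∣m
  ...   | inj₂ (divides d refl) = contradiction (m∣n∧n<m⇒n≡0 p²∣n n<p²) n≢0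
    where
    p²∣n : p * p ∣ d * p * p
    p²∣n = subst (p * p ∣_) (sym (*-assoc d p p)) (n∣m*n d)

  prime²-vertex⇒∣ : .{{_ : NonZero (p * p)}} {a : Fin (p * p)} → IsVertex (p * p) a → p ∣ toℕ a
  prime²-vertex⇒∣ {a} (_ , b , b≢0 , ab≡0) =
    prime²∣m*n⇒∣ (toℕ a) (toℕ b) b≢0 (toℕ<n b) (zeroProd⇒∣ {a = a} {b} ab≡0)

  prime²-complete : .{{_ : NonZero (p * p)}} → CompleteΓ (p * p)
  prime²-complete u v u-vertex v-vertex _ =
    ∣⇒zeroProd {a = u} {v} (*-pres-∣ (prime²-vertex⇒∣ u-vertex) (prime²-vertex⇒∣ v-vertex))

leastDivisor : ∀ n → 2 ≤ n → ∃[ p ] 2 ≤ p × p ∣ n × p Rough n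
leastDivisor n 2≤n = search 2 (n ∸ 2) (m+[n∸m]≡n 2≤n) ≤-refl 2-rough
  where
  search : ∀ k t → k + t ≡ n → 2 ≤ k → k Rough n → ∃[ p ] 2 ≤ p × p ∣ n × p Rough n
  search k t _ 2≤k k-rough with k ∣? n
  ... | yes k∣n = k , 2≤k , k∣n , k-rough
  search k zero k+0≡n _ _ | no k∤n =
    contradiction (subst (k ∣_) (trans (sym (+-identityʳ k)) k+0≡n) ∣-refl) k∤n
  search k (suc t) k+1+t≡n 2≤k k-rough | no k∤n =
    search (suc k) t (trans (sym (+-suc k t)) k+1+t≡n) (m≤n⇒m≤1+n 2≤k) (∤⇒rough-suc k∤n k-rough)

cofactor-cases : ∀ {m p} → 2 ≤ m * p → p Rough (m * p) → m ≡ 1 ⊎ p ≡ m ⊎ p < m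
cofactor-cases {zero} ()
cofactor-cases {suc zero} _ _ = inj₁ refl
cofactor-cases {m@(suc (suc _))} {p} _ p-rough
  with m≤n⇒m<n∨m≡n (rough⇒≤ (rough∧∣⇒rough p-rough (m∣m*n p)))
... | inj₁ p<m = inj₂ (inj₂ p<m)
... | inj₂ p≡m = inj₂ (inj₁ p≡m)

∤1+ : ∀ {p} → 2 ≤ p → ¬ p ∣ suc p
∤1+ {p} 2≤p p∣1+p = <⇒≢ 2≤p (sym (∣1⇒≡1 (∣m+n∣m⇒∣n (subst (p ∣_) (+-comm 1 p) p∣1+p) ∣-refl)))

p≤length-without : ∀ {m p} → 2 ≤ p → p < m → p ≤ length (without m (multiples p (pred m)))
p≤length-without {m} {p} 2≤p p<m with m≤n⇒m<n∨m≡n p<m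
... | inj₂ refl = ≤-reflexive (sym (begin
  length (without (suc p) (multiples p p))
    ≡⟨ cong length (filter-all (_≢? (suc p)) none-is-1+p) ⟩
  length (multiples p p)                   ≡⟨ length-applyUpTo _ p ⟩
  p                                        ∎))
  where
  open ≡-Reasoning
  none-is-1+p : All (_≢ suc p) (multiples p p)
  none-is-1+p = AllP.applyUpTo⁺₂ _ p (λ i eq → ∤1+ 2≤p (subst (p ∣_) eq (n∣m*n (suc i))))
... | inj₁ 1+p<m = s≤s⁻¹ (begin
  suc p                                        ≤⟨ suc[m]≤n⇒m≤pred[n] 1+p<m ⟩
  pred m                                       ≡⟨ length-applyUpTo _ (pred m) ⟨
  length (multiples p (pred m))
    ≤⟨ length≤suc-length-without m (multiples-unique p (pred m) {{p≢0}}) ⟩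
  suc (length (without m (multiples p (pred m)))) ∎)
  where
  open ≤-Reasoning
  p≢0 : NonZero p
  p≢0 = >-nonZero (<-trans z<s 2≤p)

module _ {m p : ℕ} .{{_ : NonZero (m * p)}} (2≤p : 2 ≤ p) (p<m : p < m) where

  private
    instance
      p≢0 : NonZero p
      p≢0 = m*n≢0⇒n≢0 m
      m≢0 : NonZero m
      m≢0 = m*n≢0⇒m≢0 m

    N : ℕ
    N = m * p

    p<N : p < N
    p<N = subst (_< N) (*-identityˡ p) (*-monoˡ-< p (<-trans 2≤p p<m))

    m<N : m < N
    m<N = subst (_< N) (*-identityʳ m) (*-monoʳ-< m 2≤p)

    P M : Fin N
    P = fromℕ< p<N
    M = fromℕ< m<N

    P-vertex : IsVertex N P
    P-vertex = isVertex {a = P} {b = M} (fromℕ<-nonZeroElt p<N) (fromℕ<-nonZeroElt m<N)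
      (∣-fromℕ< p<N m<N (∣-reflexive (*-comm m p)))

    M-vertex : IsVertex N M
    M-vertex = isVertex {a = M} {b = P} (fromℕ<-nonZeroElt m<N) (fromℕ<-nonZeroElt p<N)
      (∣-fromℕ< m<N p<N ∣-refl)

    degree-P≤ : degree N P ≤ pred p
    degree-P≤ = subst (degree N P ≤_) (length-applyUpTo _ (pred p)) (degree≤ P neighbour⇒multiple)
      where
      neighbour⇒multiple : ∀ {v} → Adj N P v → toℕ v ∈ multiples m (pred p)
      neighbour⇒multiple {v} (_ , (v≢0 , _) , _ , Pv≡0) =
        ∈-multiples⁺ {k = p} v≢0 (subst (toℕ v <_) (*-comm m p) (toℕ<n v)) (*-cancelˡ-∣ p p*m∣p*v)
        where
        p*m∣p*v : p * m ∣ p * toℕ v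
        p*m∣p*v = subst₂ (λ x y → x ∣ y * toℕ v) (*-comm m p) (toℕ-fromℕ< p<N)
          (zeroProd⇒∣ {a = P} {b = v} Pv≡0)

    p≤degree-M : p ≤ degree N M
    p≤degree-M = ≤-trans (p≤length-without 2≤p p<m)
      (≤degree M (Unique.filter⁺ (_≢? m) (multiples-unique p (pred m))) multiple⇒neighbour)
      where
      multiple⇒neighbour : ∀ {y} → y ∈ without m (multiples p (pred m)) → ∃[ v ] toℕ v ≡ y × Adj N M v
      multiple⇒neighbour y∈
        with y∈multiples , y≢m ← ∈-filter⁻ (_≢? m) {xs = multiples p (pred m)} y∈
        with i , i<pred[m] , refl ← ∈-applyUpTo⁻ (λ i → suc i * p) y∈multiples =
        Y , toℕ-fromℕ< y<N ,
        adjacent M-vertex (fromℕ<-nonZeroElt {{m*n≢0 (suc i) p}} y<N) M≢Y (∣-fromℕ< m<N y<N N∣m*y)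
        where
        y<N : suc i * p < N
        y<N = *-monoˡ-< p (m≤pred[n]⇒suc[m]≤n {n = m} i<pred[m])
        Y : Fin N
        Y = fromℕ< y<N
        M≢Y : M ≢ Y
        M≢Y M≡Y = y≢m (trans (sym (toℕ-fromℕ< y<N)) (trans (cong toℕ (sym M≡Y)) (toℕ-fromℕ< m<N)))
        N∣m*y : N ∣ m * (suc i * p)
        N∣m*y = *-pres-∣ {m} {m} ∣-refl (n∣m*n (suc i))

  ¬RegularΓ : ¬ RegularΓ (m * p)
  ¬RegularΓ regular = <⇒≱ (m≤pred[n]⇒suc[m]≤n ≤-refl) (begin
    p               ≤⟨ p≤degree-M ⟩
    degree N M      ≡⟨ regular M P M-vertex P-vertex ⟩
    degree N P      ≤⟨ degree-P≤ ⟩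
    pred p          ∎)
    where open ≤-Reasoning

theorem2p15 : (n : ℕ) → .{{_ : NonZero n}} → 2 ≤ n →
    NonEmptyΓ n → RegularΓ n → CompleteΓ n
theorem2p15 n 2≤n (u , u-vertex) regular with leastDivisor n 2≤n
... | p , 2≤p , divides m refl , p-rough
  with p-prime ← rough∧∣⇒prime {{n>1⇒nonTrivial 2≤p}} p-rough (n∣m*n m)
  with cofactor-cases {m} 2≤n p-rough
... | inj₁ refl        = contradiction u-vertex (prime-¬IsVertex (subst Prime (sym (*-identityˡ p)) p-prime))
... | inj₂ (inj₁ refl) = prime²-complete p-prime
... | inj₂ (inj₂ p<m)  = contradiction regular (¬RegularΓ 2≤p p<m)
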